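{- Let $t\ge1$. There exist (on a suitable finite ground set $V$) simple $[t]$-trades of each of the following volumes: (i) $2^{t+1}+2^{t-1}-2^i$ for $i=0,\dots,t-2$; (ii) $2^{t+1}+2^{t-1}-3\cdot 2^i$ for $i=0,\dots,t-3$.
   Context: Let $V=\{1,\dots,v\}$. A $[t]$-trade is a pair $T=(T_+,T_-)$ of disjoint finite multisets of subsets of $V$ (blocks) such that for every $i\in\{0,\dots,t\}$ every $i$-subset of $V$ is contained in the same number of blocks of $T_+$ as of $T_-$ (with multiplicity). It is simple if no block is repeated; its volume is $\mathrm{vol}(T)=|T_+|=|T_-|$. -}

module Defs where

open import Data.Nat using (ℕ; _≤_)
open import Data.List using (List; length; filter)
open import Data.List.Membership.Propositional using (_∈_)
open import Data.List.Relation.Unary.Unique.Propositional using (Unique)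
open import Data.Fin.Subset using (Subset; _⊆_; ∣_∣)
open import Data.Fin.Subset.Properties using (_⊆?_)
open import Data.Product using (_×_)
open import Relation.Binary.PropositionalEquality using (_≡_)
open import Relation.Nullary using (¬_)

-- A finite multiset of blocks is represented as a list of blocks
-- (multiplicity = number of occurrences; order irrelevant for everything below).

count : {v : ℕ} → Subset v → List (Subset v) → ℕ
count S B = length (filter (S ⊆?_) B)

Disjoint : {v : ℕ} → List (Subset v) → List (Subset v) → Set
Disjoint {v} T₊ T₋ = (B : Subset v) → B ∈ T₊ → ¬ (B ∈ T₋)

IsTrade : (t : ℕ) {v : ℕ} → List (Subset v) → List (Subset v) → Set
IsTrade t {v} T₊ T₋ =
  Disjoint T₊ T₋ ×
  ((i : ℕ) → i ≤ t → (S : Subset v) → ∣ S ∣ ≡ i → count S T₊ ≡ count S T₋)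

IsSimpleTrade : (t : ℕ) {v : ℕ} → List (Subset v) → List (Subset v) → Set
IsSimpleTrade t T₊ T₋ = IsTrade t T₊ T₋ × Unique T₊ × Unique T₋

HasSimpleTradeOfVolume : (t m : ℕ) → Set
HasSimpleTradeOfVolume t m =
  Σ ℕ λ v → Σ (List (Subset v)) λ T₊ → Σ (List (Subset v)) λ T₋ →
    IsSimpleTrade t T₊ T₋ × length T₊ ≡ m
  where open import Data.Product using (Σ)

-- Write a pair (T₊, T₋) of lists of blocks as a formal difference T₊ − T₋, and let cone X Y
-- add a new point to the blocks of X and not to those of Y. Doubling, cone X (−X), turns a
-- simple [t]-trade of volume m into a simple [t+1]-trade of volume 2m; lifting, cone ∅ X,
-- keeps t and the volume. Call simple [t]-trades N, L and a simple G with G = N + L a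
-- decomposition of total s = vol N + vol L and deficiency c = s − vol G: it records that
-- adding N and L cancels c pairs of blocks. Then
--   double (lift N),  lift (double L),  cone (lift N) (cone L (−G))
-- is a decomposition for t + 1 of total 2s and the same deficiency c. Two decompositions on
-- five points with t = 1, s = 5 and c = 1, 3 therefore give simple [m+1]-trades of volume
-- 5·2^m − c, and i further doublings give 2^i (5·2^m − c) = 2^(t+1) + 2^(t−1) − c·2^i.
module Submission where

open import Defs
open import Data.Nat using (ℕ; zero; suc; _≤_; _<_; _+_; _*_; _∸_; _^_; z≤n; s≤s; z<s; _≤?_)
open import Data.Nat.Properties
  using ( +-identityʳ; *-distribˡ-+; *-assoc; *-identityˡ; <-≤-trans; m<m+n
        ; m≤n⇒∃[o]m+o≡n; m+n∸n≡m; ^-distribˡ-+-*)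
open import Data.Nat.Tactic.RingSolver using (solve-∀)
open import Data.Integer as ℤ using (ℤ; +_; 0ℤ)
import Data.Integer.Properties as ℤₚ
import Data.Integer.Tactic.RingSolver as ℤ-Solver
open import Algebra.Properties.CommutativeSemigroup ℤₚ.+-commutativeSemigroup
  using () renaming (interchange to ℤ-interchange)
open import Data.Bool using (Bool; true; false)
open import Data.Bool.Properties using () renaming (_≟_ to _≟ᵇ_)
open import Data.Fin using (#_)
open import Data.List using (List; []; _∷_; _++_; map; length; filter)
open import Data.List.Properties using (length-++; length-map; filter-++; filter-all; ++-identityʳ)
open import Data.List.Membership.Propositional using (_∈_)
open import Data.List.Membership.Propositional.Properties using (∈-map⁻; ∈-++⁻)
open import Data.List.Membership.DecPropositional using () renaming (_∈?_ to member?)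
open import Data.List.Relation.Unary.All as All using (all?)
open import Data.List.Relation.Unary.AllPairs using ([])
open import Data.List.Relation.Unary.Unique.Propositional using (Unique)
import Data.List.Relation.Unary.Unique.Propositional.Properties as Unique
open import Data.List.Relation.Unary.Unique.DecPropositional using (unique?)
open import Data.Fin.Subset using (Subset; inside; outside; ⊥; ⁅_⁆; _∪_; ∣_∣)
open import Data.Fin.Subset.Properties using (_⊆?_; ⊆-min; ∣⊥∣≡0; anySubset?)
open import Data.Vec using (_∷_)
open import Data.Vec.Properties using (∷-injectiveʳ; ≡-dec)
open import Data.Product using (_×_; _,_; proj₁; proj₂)
open import Data.Sum using (inj₁; inj₂)
open import Function using (_∘_)
open import Relation.Binary using (Setoid; DecidableEquality)
open import Relation.Binary.PropositionalEquality
open import Relation.Nullary using (¬_; Dec; does; ¬?; _×-dec_; _→-dec_)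
open import Relation.Nullary.Decidable using (map′; decidable-stable; from-yes; True; toWitness)
open import Relation.Unary using (Pred; Decidable)

private variable
  t v : ℕ

record Pair (v : ℕ) : Set where
  constructor _⊟_
  field
    plus minus : List (Subset v)

open Pair

∅ : Pair v
∅ = [] ⊟ []

opposite : Pair v → Pair v
opposite (P ⊟ N) = N ⊟ P

_⊕_ : Pair v → Pair v → Pair v
(P ⊟ N) ⊕ (P′ ⊟ N′) = (P ++ P′) ⊟ (N ++ N′)

glue : List (Subset v) → List (Subset v) → List (Subset (suc v))
glue xs ys = map (inside ∷_) xs ++ map (outside ∷_) ys

cone : Pair v → Pair v → Pair (suc v)
cone (P ⊟ N) (P′ ⊟ N′) = glue P P′ ⊟ glue N N′

lift : Pair v → Pair (suc v)
lift = cone ∅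

double : Pair v → Pair (suc v)
double X = cone X (opposite X)

volume : Pair v → ℕ
volume = length ∘ plus

count-++ : (S : Subset v) (xs ys : List (Subset v)) →
           count S (xs ++ ys) ≡ count S xs + count S ys
count-++ S xs ys = trans (cong length (filter-++ (S ⊆?_) xs ys)) (length-++ (filter (S ⊆?_) xs))

count-inside-map-inside : (S : Subset v) (xs : List (Subset v)) →
                          count (inside ∷ S) (map (inside ∷_) xs) ≡ count S xs
count-inside-map-inside S [] = refl
count-inside-map-inside S (x ∷ xs) with does (S ⊆? x)
... | true  = cong suc (count-inside-map-inside S xs)
... | false = count-inside-map-inside S xs

count-inside-map-outside : (S : Subset v) (xs : List (Subset v)) →
                           count (inside ∷ S) (map (outside ∷_) xs) ≡ 0
count-inside-map-outside S []       = refl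
count-inside-map-outside S (x ∷ xs) = count-inside-map-outside S xs

count-outside-map : (S : Subset v) (b : Bool) (xs : List (Subset v)) →
                    count (outside ∷ S) (map (b ∷_) xs) ≡ count S xs
count-outside-map S b [] = refl
count-outside-map S b (x ∷ xs) with does (S ⊆? x)
... | true  = cong suc (count-outside-map S b xs)
... | false = count-outside-map S b xs

count-inside-glue : (S : Subset v) (xs ys : List (Subset v)) →
                    count (inside ∷ S) (glue xs ys) ≡ count S xs
count-inside-glue S xs ys = begin
  count (inside ∷ S) (glue xs ys)
    ≡⟨ count-++ (inside ∷ S) (map (inside ∷_) xs) (map (outside ∷_) ys) ⟩
  count (inside ∷ S) (map (inside ∷_) xs) + count (inside ∷ S) (map (outside ∷_) ys)
    ≡⟨ cong₂ _+_ (count-inside-map-inside S xs) (count-inside-map-outside S ys) ⟩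
  count S xs + 0
    ≡⟨ +-identityʳ _ ⟩
  count S xs ∎
  where open ≡-Reasoning

count-outside-glue : (S : Subset v) (xs ys : List (Subset v)) →
                     count (outside ∷ S) (glue xs ys) ≡ count S xs + count S ys
count-outside-glue S xs ys =
  trans (count-++ (outside ∷ S) (map (inside ∷_) xs) (map (outside ∷_) ys))
        (cong₂ _+_ (count-outside-map S inside xs) (count-outside-map S outside ys))

count-⊥ : (xs : List (Subset v)) → count ⊥ xs ≡ length xs
count-⊥ xs = cong length (filter-all (⊥ ⊆?_) {xs} (All.tabulate (λ _ → ⊆-min _)))

δ : Pair v → Subset v → ℤ
δ (P ⊟ N) S = + count S P ℤ.- + count S N

+[m+n]-+[o+p]≡[+m-+o]+[+n-+p] : ∀ m n o p →
  + (m + n) ℤ.- + (o + p) ≡ (+ m ℤ.- + o) ℤ.+ (+ n ℤ.- + p)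
+[m+n]-+[o+p]≡[+m-+o]+[+n-+p] m n o p rewrite ℤₚ.pos-+ m n | ℤₚ.pos-+ o p =
  regroup (+ m) (+ n) (+ o) (+ p)
  where
  regroup : ∀ i j k l → (i ℤ.+ j) ℤ.- (k ℤ.+ l) ≡ (i ℤ.- k) ℤ.+ (j ℤ.- l)
  regroup = ℤ-Solver.solve-∀

δ-⊕ : (X Y : Pair v) (S : Subset v) → δ (X ⊕ Y) S ≡ δ X S ℤ.+ δ Y S
δ-⊕ (P ⊟ N) (P′ ⊟ N′) S rewrite count-++ S P P′ | count-++ S N N′ =
  +[m+n]-+[o+p]≡[+m-+o]+[+n-+p] (count S P) (count S P′) (count S N) (count S N′)

δ-opposite : (X : Pair v) (S : Subset v) → δ (opposite X) S ≡ ℤ.- δ X S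
δ-opposite (P ⊟ N) S = j-i≡-[i-j] (+ count S P) (+ count S N)
  where
  j-i≡-[i-j] : ∀ i j → j ℤ.- i ≡ ℤ.- (i ℤ.- j)
  j-i≡-[i-j] = ℤ-Solver.solve-∀

δ-cone-inside : (X Y : Pair v) (S : Subset v) → δ (cone X Y) (inside ∷ S) ≡ δ X S
δ-cone-inside (P ⊟ N) (P′ ⊟ N′) S
  rewrite count-inside-glue S P P′ | count-inside-glue S N N′ = refl

δ-cone-outside : (X Y : Pair v) (S : Subset v) → δ (cone X Y) (outside ∷ S) ≡ δ X S ℤ.+ δ Y S
δ-cone-outside (P ⊟ N) (P′ ⊟ N′) S
  rewrite count-outside-glue S P P′ | count-outside-glue S N N′ =
    +[m+n]-+[o+p]≡[+m-+o]+[+n-+p] (count S P) (count S P′) (count S N) (count S N′)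

infix 4 _≃_

-- As S ranges over all subsets, X ≃ Y says (by Möbius inversion) that X and Y are equal
-- as formal differences of multisets of blocks.

record _≃_ (X Y : Pair v) : Set where
  constructor pointwise
  field
    at : (S : Subset v) → δ X S ≡ δ Y S

open _≃_

≃-refl : {X : Pair v} → X ≃ X
≃-refl .at S = refl

≃-sym : {X Y : Pair v} → X ≃ Y → Y ≃ X
≃-sym X≃Y .at S = sym (X≃Y .at S)

≃-trans : {X Y Z : Pair v} → X ≃ Y → Y ≃ Z → X ≃ Z
≃-trans X≃Y Y≃Z .at S = trans (X≃Y .at S) (Y≃Z .at S)

≃-setoid : ℕ → Setoid _ _
≃-setoid v = record
  { Carrier       = Pair v
  ; _≈_           = _≃_
  ; isEquivalence = record { refl = ≃-refl ; sym = ≃-sym ; trans = ≃-trans }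
  }

opposite-cong : {X Y : Pair v} → X ≃ Y → opposite X ≃ opposite Y
opposite-cong {X = X} {Y} X≃Y .at S = begin
  δ (opposite X) S  ≡⟨ δ-opposite X S ⟩
  ℤ.- δ X S         ≡⟨ cong ℤ.-_ (X≃Y .at S) ⟩
  ℤ.- δ Y S         ≡⟨ δ-opposite Y S ⟨
  δ (opposite Y) S  ∎
  where open ≡-Reasoning

cone-cong : {X X′ Y Y′ : Pair v} → X ≃ X′ → Y ≃ Y′ → cone X Y ≃ cone X′ Y′
cone-cong {X = X} {X′} {Y} {Y′} X≃X′ Y≃Y′ .at (inside ∷ S) = begin
  δ (cone X Y) (inside ∷ S)    ≡⟨ δ-cone-inside X Y S ⟩
  δ X S                        ≡⟨ X≃X′ .at S ⟩
  δ X′ S                       ≡⟨ δ-cone-inside X′ Y′ S ⟨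
  δ (cone X′ Y′) (inside ∷ S)  ∎
  where open ≡-Reasoning
cone-cong {X = X} {X′} {Y} {Y′} X≃X′ Y≃Y′ .at (outside ∷ S) = begin
  δ (cone X Y) (outside ∷ S)    ≡⟨ δ-cone-outside X Y S ⟩
  δ X S ℤ.+ δ Y S               ≡⟨ cong₂ ℤ._+_ (X≃X′ .at S) (Y≃Y′ .at S) ⟩
  δ X′ S ℤ.+ δ Y′ S             ≡⟨ δ-cone-outside X′ Y′ S ⟨
  δ (cone X′ Y′) (outside ∷ S)  ∎
  where open ≡-Reasoning

⊕-identityʳ : (X : Pair v) → X ⊕ ∅ ≃ X
⊕-identityʳ (P ⊟ N) .at S rewrite ++-identityʳ P | ++-identityʳ N = refl

cone-⊕ : (X Y Z W : Pair v) → cone X Y ⊕ cone Z W ≃ cone (X ⊕ Z) (Y ⊕ W)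
cone-⊕ X Y Z W .at (inside ∷ S) = begin
  δ (cone X Y ⊕ cone Z W) (inside ∷ S)                   ≡⟨ δ-⊕ (cone X Y) (cone Z W) (inside ∷ S) ⟩
  δ (cone X Y) (inside ∷ S) ℤ.+ δ (cone Z W) (inside ∷ S) ≡⟨ cong₂ ℤ._+_ (δ-cone-inside X Y S) (δ-cone-inside Z W S) ⟩
  δ X S ℤ.+ δ Z S                                         ≡⟨ δ-⊕ X Z S ⟨
  δ (X ⊕ Z) S                                             ≡⟨ δ-cone-inside (X ⊕ Z) (Y ⊕ W) S ⟨
  δ (cone (X ⊕ Z) (Y ⊕ W)) (inside ∷ S)                   ∎
  where open ≡-Reasoning
cone-⊕ X Y Z W .at (outside ∷ S) = begin
  δ (cone X Y ⊕ cone Z W) (outside ∷ S)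
    ≡⟨ δ-⊕ (cone X Y) (cone Z W) (outside ∷ S) ⟩
  δ (cone X Y) (outside ∷ S) ℤ.+ δ (cone Z W) (outside ∷ S)
    ≡⟨ cong₂ ℤ._+_ (δ-cone-outside X Y S) (δ-cone-outside Z W S) ⟩
  (δ X S ℤ.+ δ Y S) ℤ.+ (δ Z S ℤ.+ δ W S)
    ≡⟨ ℤ-interchange (δ X S) (δ Y S) (δ Z S) (δ W S) ⟩
  (δ X S ℤ.+ δ Z S) ℤ.+ (δ Y S ℤ.+ δ W S)
    ≡⟨ cong₂ ℤ._+_ (δ-⊕ X Z S) (δ-⊕ Y W S) ⟨
  δ (X ⊕ Z) S ℤ.+ δ (Y ⊕ W) S
    ≡⟨ δ-cone-outside (X ⊕ Z) (Y ⊕ W) S ⟨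
  δ (cone (X ⊕ Z) (Y ⊕ W)) (outside ∷ S) ∎
  where open ≡-Reasoning

Balanced : ℕ → Pair v → Set
Balanced {v} t X = (S : Subset v) → ∣ S ∣ ≤ t → δ X S ≡ 0ℤ

balanced-resp-≃ : {X Y : Pair v} → X ≃ Y → Balanced t Y → Balanced t X
balanced-resp-≃ X≃Y bal S h = trans (X≃Y .at S) (bal S h)

balanced-⊕ : {X Y : Pair v} → Balanced t X → Balanced t Y → Balanced t (X ⊕ Y)
balanced-⊕ {X = X} {Y} balX balY S h =
  trans (δ-⊕ X Y S) (cong₂ ℤ._+_ (balX S h) (balY S h))

balanced-lift : {X : Pair v} → Balanced t X → Balanced t (lift X)
balanced-lift {X = X} bal (inside ∷ S)  h = δ-cone-inside ∅ X S
balanced-lift {X = X} bal (outside ∷ S) h =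
  trans (δ-cone-outside ∅ X S) (trans (ℤₚ.+-identityˡ (δ X S)) (bal S h))

balanced-double : {X : Pair v} → Balanced t X → Balanced (suc t) (double X)
balanced-double {X = X} bal (inside ∷ S) (s≤s h) = trans (δ-cone-inside X (opposite X) S) (bal S h)
balanced-double {X = X} bal (outside ∷ S) h = begin
  δ (double X) (outside ∷ S)          ≡⟨ δ-cone-outside X (opposite X) S ⟩
  δ X S ℤ.+ δ (opposite X) S          ≡⟨ cong (ℤ._+_ (δ X S)) (δ-opposite X S) ⟩
  δ X S ℤ.+ ℤ.- δ X S                 ≡⟨ ℤₚ.+-inverseʳ (δ X S) ⟩
  0ℤ                                  ∎
  where open ≡-Reasoning

balanced⇒count-≡ : {X : Pair v} → Balanced t X →
                   (S : Subset v) → ∣ S ∣ ≤ t → count S (plus X) ≡ count S (minus X)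
balanced⇒count-≡ bal S h = ℤₚ.+-injective (ℤₚ.i-j≡0⇒i≡j _ _ (bal S h))

balanced⇒length-≡ : {X : Pair v} → Balanced t X → length (plus X) ≡ length (minus X)
balanced⇒length-≡ {v} {X = X} bal = begin
  length (plus X)    ≡⟨ count-⊥ (plus X) ⟨
  count ⊥ (plus X)   ≡⟨ balanced⇒count-≡ {X = X} bal ⊥ (subst (_≤ _) (sym (∣⊥∣≡0 v)) z≤n) ⟩
  count ⊥ (minus X)  ≡⟨ count-⊥ (minus X) ⟩
  length (minus X)   ∎
  where open ≡-Reasoning

Simple : Pair v → Set
Simple X = Disjoint (plus X) (minus X) × Unique (plus X) × Unique (minus X)

module _ {xs ys : List (Subset v)} where

  ∈-glue-inside⁻ : {x : Subset v} → inside ∷ x ∈ glue xs ys → x ∈ xs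
  ∈-glue-inside⁻ x∈ with ∈-++⁻ (map (inside ∷_) xs) x∈
  ... | inj₁ x∈xs with ∈-map⁻ (inside ∷_) x∈xs
  ...   | _ , x∈xs′ , refl = x∈xs′
  ∈-glue-inside⁻ x∈ | inj₂ x∈ys with ∈-map⁻ (outside ∷_) x∈ys
  ...   | _ , _ , ()

  ∈-glue-outside⁻ : {y : Subset v} → outside ∷ y ∈ glue xs ys → y ∈ ys
  ∈-glue-outside⁻ y∈ with ∈-++⁻ (map (inside ∷_) xs) y∈
  ... | inj₁ y∈xs with ∈-map⁻ (inside ∷_) y∈xs
  ...   | _ , _ , ()
  ∈-glue-outside⁻ y∈ | inj₂ y∈ys with ∈-map⁻ (outside ∷_) y∈ys
  ...   | _ , y∈ys′ , refl = y∈ys′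

  unique-glue : Unique xs → Unique ys → Unique (glue xs ys)
  unique-glue uxs uys =
    Unique.++⁺ (Unique.map⁺ ∷-injectiveʳ uxs) (Unique.map⁺ ∷-injectiveʳ uys) inside≢outside
    where
    inside≢outside : ∀ {B} → ¬ (B ∈ map (inside ∷_) xs × B ∈ map (outside ∷_) ys)
    inside≢outside (B∈xs , B∈ys) with ∈-map⁻ (inside ∷_) B∈xs | ∈-map⁻ (outside ∷_) B∈ys
    ... | _ , _ , refl | _ , _ , ()

disjoint-glue : {xs ys xs′ ys′ : List (Subset v)} →
  Disjoint xs xs′ → Disjoint ys ys′ → Disjoint (glue xs ys) (glue xs′ ys′)
disjoint-glue disjoint-xs disjoint-ys (inside ∷ B) B∈ B∈′ =
  disjoint-xs B (∈-glue-inside⁻ B∈) (∈-glue-inside⁻ B∈′)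
disjoint-glue disjoint-xs disjoint-ys (outside ∷ B) B∈ B∈′ =
  disjoint-ys B (∈-glue-outside⁻ B∈) (∈-glue-outside⁻ B∈′)

simple-∅ : Simple (∅ {v})
simple-∅ = (λ _ ()) , [] , []

simple-opposite : {X : Pair v} → Simple X → Simple (opposite X)
simple-opposite (disjoint , unique₊ , unique₋) = (λ B B∈₋ B∈₊ → disjoint B B∈₊ B∈₋) , unique₋ , unique₊

simple-cone : {X Y : Pair v} → Simple X → Simple Y → Simple (cone X Y)
simple-cone (disjointX , uX₊ , uX₋) (disjointY , uY₊ , uY₋) =
  disjoint-glue disjointX disjointY , unique-glue uX₊ uY₊ , unique-glue uX₋ uY₋

length-glue : (xs ys : List (Subset v)) → length (glue xs ys) ≡ length xs + length ys
length-glue xs ys =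
  trans (length-++ (map (inside ∷_) xs)) (cong₂ _+_ (length-map _ xs) (length-map _ ys))

volume-cone : (X Y : Pair v) → volume (cone X Y) ≡ volume X + volume Y
volume-cone X Y = length-glue (plus X) (plus Y)

volume-lift : (X : Pair v) → volume (lift X) ≡ volume X
volume-lift = volume-cone ∅

volume-double : {X : Pair v} → Balanced t X → volume (double X) ≡ 2 * volume X
volume-double {X = X} bal = begin
  volume (double X)                          ≡⟨ volume-cone X (opposite X) ⟩
  volume X + length (minus X)                ≡⟨ cong (_+_ (volume X)) (balanced⇒length-≡ {X = X} bal) ⟨
  volume X + volume X                        ≡⟨ cong (_+_ (volume X)) (+-identityʳ (volume X)) ⟨
  2 * volume X                               ∎
  where open ≡-Reasoning

record SimpleTrade (t v : ℕ) : Set where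
  field
    trade    : Pair v
    balanced : Balanced t trade
    simple   : Simple trade

open SimpleTrade

lift-trade : SimpleTrade t v → SimpleTrade t (suc v)
lift-trade T = record
  { trade    = lift (trade T)
  ; balanced = balanced-lift {X = trade T} (balanced T)
  ; simple   = simple-cone simple-∅ (simple T)
  }

double-trade : SimpleTrade t v → SimpleTrade (suc t) (suc v)
double-trade T = record
  { trade    = double (trade T)
  ; balanced = balanced-double {X = trade T} (balanced T)
  ; simple   = simple-cone (simple T) (simple-opposite (simple T))
  }

doubleⁱ : (i : ℕ) → SimpleTrade t v → SimpleTrade (i + t) (i + v)
doubleⁱ zero    T = T
doubleⁱ (suc i) T = double-trade (doubleⁱ i T)

volume-doubleⁱ : (i : ℕ) (T : SimpleTrade t v) →
                 volume (trade (doubleⁱ i T)) ≡ 2 ^ i * volume (trade T)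
volume-doubleⁱ zero    T = sym (*-identityˡ _)
volume-doubleⁱ (suc i) T = begin
  volume (double (trade (doubleⁱ i T)))  ≡⟨ volume-double {X = trade (doubleⁱ i T)} (balanced (doubleⁱ i T)) ⟩
  2 * volume (trade (doubleⁱ i T))       ≡⟨ cong (_*_ 2) (volume-doubleⁱ i T) ⟩
  2 * (2 ^ i * volume (trade T))         ≡⟨ *-assoc 2 (2 ^ i) _ ⟨
  2 ^ suc i * volume (trade T)           ∎
  where open ≡-Reasoning

simpleTrade⇒hasVolume : (T : SimpleTrade t v) → HasSimpleTradeOfVolume t (volume (trade T))
simpleTrade⇒hasVolume {t} {v} T =
  v , plus (trade T) , minus (trade T) , ((disjoint , counts-≡) , unique₊ , unique₋) , refl
  where
  disjoint = proj₁ (simple T)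
  unique₊  = proj₁ (proj₂ (simple T))
  unique₋  = proj₂ (proj₂ (simple T))
  counts-≡ : (i : ℕ) → i ≤ t → (S : Subset v) → ∣ S ∣ ≡ i →
             count S (plus (trade T)) ≡ count S (minus (trade T))
  counts-≡ i i≤t S refl = balanced⇒count-≡ {X = trade T} (balanced T) S i≤t

record Decomposition (t s c : ℕ) : Set where
  field
    points      : ℕ
    N L         : SimpleTrade t points
    G           : Pair points
    simple-G    : Simple G
    G≃N⊕L       : G ≃ trade N ⊕ trade L
    total       : volume (trade N) + volume (trade L) ≡ s
    deficiency  : volume G + c ≡ s

  G-trade : SimpleTrade t points
  G-trade = record
    { trade    = G
    ; balanced = balanced-resp-≃ G≃N⊕L
                   (balanced-⊕ {X = trade N} {Y = trade L} (balanced N) (balanced L))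
    ; simple   = simple-G
    }

step-volume : ∀ n l g c s → n + l ≡ s → g + c ≡ s → (n + (l + g)) + c ≡ 2 * s
step-volume n l g c s refl g+c≡s = begin
  (n + (l + g)) + c    ≡⟨ rearrange n l g c ⟩
  (n + l) + (g + c)    ≡⟨ cong (_+_ (n + l)) g+c≡s ⟩
  (n + l) + (n + l)    ≡⟨ cong (_+_ (n + l)) (+-identityʳ (n + l)) ⟨
  2 * (n + l)          ∎
  where
  open ≡-Reasoning
  rearrange : ∀ n l g c → (n + (l + g)) + c ≡ (n + l) + (g + c)
  rearrange = solve-∀

step : ∀ {t s c} → Decomposition t s c → Decomposition (suc t) (2 * s) c
step {t} {s} {c} D = record
  { points     = suc (suc points)
  ; N          = double-trade (lift-trade N)
  ; L          = lift-trade (double-trade L)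
  ; G          = G′
  ; simple-G   = simple-cone (simple (lift-trade N))
                   (simple-cone (simple L) (simple-opposite simple-G))
  ; G≃N⊕L      = G′≃N′⊕L′
  ; total      = total′
  ; deficiency = trans (cong (_+ c) volume-G′)
                   (step-volume (volume TN) (volume TL) (volume G) c s total deficiency)
  }
  where
  open Decomposition D
  TN = trade N
  TL = trade L
  G′ = cone (lift TN) (cone TL (opposite G))

  G′≃N′⊕L′ : G′ ≃ double (lift TN) ⊕ lift (double TL)
  G′≃N′⊕L′ = ≃-sym (begin
    cone (lift TN) (opposite (lift TN)) ⊕ cone ∅ (double TL)
      ≈⟨ cone-⊕ (lift TN) (opposite (lift TN)) ∅ (double TL) ⟩
    cone (lift TN ⊕ ∅) (cone ∅ (opposite TN) ⊕ cone TL (opposite TL))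
      ≈⟨ cone-cong (⊕-identityʳ (lift TN)) (cone-⊕ ∅ (opposite TN) TL (opposite TL)) ⟩
    cone (lift TN) (cone TL (opposite (TN ⊕ TL)))
      ≈⟨ cone-cong {X = lift TN} ≃-refl (cone-cong {X = TL} ≃-refl (opposite-cong (≃-sym G≃N⊕L))) ⟩
    G′ ∎)
    where
    open import Relation.Binary.Reasoning.Setoid (≃-setoid (suc (suc points)))

  volume-G′ : volume G′ ≡ volume TN + (volume TL + volume G)
  volume-G′ = begin
    volume G′                                          ≡⟨ volume-cone (lift TN) (cone TL (opposite G)) ⟩
    volume (lift TN) + volume (cone TL (opposite G))    ≡⟨ cong₂ _+_ (volume-lift TN) (volume-cone TL (opposite G)) ⟩
    volume TN + (volume TL + length (minus G))          ≡⟨ cong (λ g → volume TN + (volume TL + g))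
                                                             (balanced⇒length-≡ {X = G} (balanced G-trade)) ⟨
    volume TN + (volume TL + volume G)                  ∎
    where open ≡-Reasoning

  total′ : volume (double (lift TN)) + volume (lift (double TL)) ≡ 2 * s
  total′ = begin
    volume (double (lift TN)) + volume (lift (double TL))
      ≡⟨ cong₂ _+_ (volume-double {X = lift TN} (balanced (lift-trade N)))
                   (volume-lift (double TL)) ⟩
    2 * volume (lift TN) + volume (double TL)
      ≡⟨ cong₂ _+_ (cong (_*_ 2) (volume-lift TN)) (volume-double {X = TL} (balanced L)) ⟩
    2 * volume TN + 2 * volume TL   ≡⟨ *-distribˡ-+ 2 (volume TN) (volume TL) ⟨
    2 * (volume TN + volume TL)     ≡⟨ cong (_*_ 2) total ⟩
    2 * s                           ∎
    where open ≡-Reasoning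

stepⁿ : ∀ {t s c} (m : ℕ) → Decomposition t s c → Decomposition (m + t) (2 ^ m * s) c
stepⁿ {t} {s} {c} zero D = subst (λ s → Decomposition t s c) (sym (*-identityˡ s)) D
stepⁿ {t} {s} {c} (suc m) D =
  subst (λ s → Decomposition (suc (m + t)) s c) (sym (*-assoc 2 (2 ^ m) s)) (step (stepⁿ m D))

∀-subset? : ∀ {ℓ} {P : Pred (Subset v) ℓ} → Decidable P → Dec (∀ S → P S)
∀-subset? P? = map′ (λ ∄¬P S → decidable-stable (P? S) (λ ¬PS → ∄¬P (S , ¬PS)))
                    (λ ∀P (S , ¬PS) → ¬PS (∀P S))
                    (¬? (anySubset? (¬? ∘ P?)))

balanced? : (t : ℕ) (X : Pair v) → Dec (Balanced t X)
balanced? t X = ∀-subset? (λ S → (∣ S ∣ ≤? t) →-dec (δ X S ℤ.≟ 0ℤ))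

_≃?_ : (X Y : Pair v) → Dec (X ≃ Y)
X ≃? Y = map′ pointwise at (∀-subset? (λ S → δ X S ℤ.≟ δ Y S))

_≟ˢ_ : DecidableEquality (Subset v)
_≟ˢ_ = ≡-dec _≟ᵇ_

disjoint? : (xs ys : List (Subset v)) → Dec (Disjoint xs ys)
disjoint? xs ys = map′ (λ all∉ B B∈xs → All.lookup all∉ B∈xs) (λ disjoint → All.tabulate (disjoint _))
                       (all? (λ B → ¬? (member? _≟ˢ_ B ys)) xs)

simple? : (X : Pair v) → Dec (Simple X)
simple? (P ⊟ N) = disjoint? P N ×-dec unique? _≟ˢ_ P ×-dec unique? _≟ˢ_ N

decided-trade : (X : Pair v) {_ : True (balanced? t X)} {_ : True (simple? X)} → SimpleTrade t v
decided-trade X {balanced} {simple} = record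
  { trade = X ; balanced = toWitness balanced ; simple = toWitness simple }

-- G₁ is N₀ + L₁ with the block {2} cancelled, G₃ is N₀ + L₃ with {2}, {3} and {2,3} cancelled.
N₀ L₁ G₁ L₃ G₃ : Pair 5
N₀ = (⁅ # 0 ⁆ ∪ ⁅ # 1 ⁆ ∷ ⁅ # 2 ⁆ ∷ ⁅ # 3 ⁆ ∷ []) ⊟ (⁅ # 0 ⁆ ∷ ⁅ # 1 ⁆ ∷ ⁅ # 2 ⁆ ∪ ⁅ # 3 ⁆ ∷ [])
L₁ = (⁅ # 2 ⁆ ∪ ⁅ # 4 ⁆ ∷ ⊥ ∷ []) ⊟ (⁅ # 2 ⁆ ∷ ⁅ # 4 ⁆ ∷ [])
G₁ = (⁅ # 0 ⁆ ∪ ⁅ # 1 ⁆ ∷ ⁅ # 3 ⁆ ∷ ⁅ # 2 ⁆ ∪ ⁅ # 4 ⁆ ∷ ⊥ ∷ [])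
   ⊟ (⁅ # 0 ⁆ ∷ ⁅ # 1 ⁆ ∷ ⁅ # 2 ⁆ ∪ ⁅ # 3 ⁆ ∷ ⁅ # 4 ⁆ ∷ [])
L₃ = (⁅ # 2 ⁆ ∪ ⁅ # 3 ⁆ ∷ ⊥ ∷ []) ⊟ (⁅ # 2 ⁆ ∷ ⁅ # 3 ⁆ ∷ [])
G₃ = (⁅ # 0 ⁆ ∪ ⁅ # 1 ⁆ ∷ ⊥ ∷ []) ⊟ (⁅ # 0 ⁆ ∷ ⁅ # 1 ⁆ ∷ [])

base₁ : Decomposition 1 5 1
base₁ = record
  { points = 5 ; N = decided-trade N₀ ; L = decided-trade L₁ ; G = G₁
  ; simple-G = from-yes (simple? G₁) ; G≃N⊕L = from-yes (G₁ ≃? (N₀ ⊕ L₁))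
  ; total = refl ; deficiency = refl }

base₃ : Decomposition 1 5 3
base₃ = record
  { points = 5 ; N = decided-trade N₀ ; L = decided-trade L₃ ; G = G₃
  ; simple-G = from-yes (simple? G₃) ; G≃N⊕L = from-yes (G₃ ≃? (N₀ ⊕ L₃))
  ; total = refl ; deficiency = refl }

2^[2+u]+2^u≡2^u*5 : ∀ u → 2 ^ (suc u + 1) + 2 ^ u ≡ 2 ^ u * 5
2^[2+u]+2^u≡2^u*5 u rewrite ^-distribˡ-+-* 2 u 1 = collect (2 ^ u)
  where
  collect : ∀ x → 2 * (x * (2 * 1)) + x ≡ x * 5
  collect = solve-∀

volume-formula : ∀ i m g c → g + c ≡ 2 ^ m * 5 →
                 2 ^ i * g ≡ (2 ^ (suc (i + m) + 1) + 2 ^ (suc (i + m) ∸ 1)) ∸ c * 2 ^ i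
volume-formula i m g c g+c≡2^m*5 = sym (begin
  (2 ^ (suc (i + m) + 1) + 2 ^ (i + m)) ∸ c * 2 ^ i  ≡⟨ cong (_∸ c * 2 ^ i) formula ⟩
  (2 ^ i * g + c * 2 ^ i) ∸ c * 2 ^ i                ≡⟨ m+n∸n≡m (2 ^ i * g) (c * 2 ^ i) ⟩
  2 ^ i * g                                          ∎)
  where
  open ≡-Reasoning
  distribute : ∀ x g c → x * (g + c) ≡ x * g + c * x
  distribute = solve-∀
  formula : 2 ^ (suc (i + m) + 1) + 2 ^ (i + m) ≡ 2 ^ i * g + c * 2 ^ i
  formula = begin
    2 ^ (suc (i + m) + 1) + 2 ^ (i + m)  ≡⟨ 2^[2+u]+2^u≡2^u*5 (i + m) ⟩
    2 ^ (i + m) * 5                      ≡⟨ cong (_* 5) (^-distribˡ-+-* 2 i m) ⟩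
    2 ^ i * 2 ^ m * 5                    ≡⟨ *-assoc (2 ^ i) (2 ^ m) 5 ⟩
    2 ^ i * (2 ^ m * 5)                  ≡⟨ cong (_*_ (2 ^ i)) g+c≡2^m*5 ⟨
    2 ^ i * (g + c)                      ≡⟨ distribute (2 ^ i) g c ⟩
    2 ^ i * g + c * 2 ^ i                ∎

simple-trade-of-volume : ∀ {c t i} → Decomposition 1 5 c → i < t →
  HasSimpleTradeOfVolume t ((2 ^ (t + 1) + 2 ^ (t ∸ 1)) ∸ c * 2 ^ i)
simple-trade-of-volume {c} {i = i} D i<t with m≤n⇒∃[o]m+o≡n i<t
... | m , refl =
  subst₂ HasSimpleTradeOfVolume (i+[m+1]≡1+[i+m] i m)
    (trans (volume-doubleⁱ i (G-trade Dₘ)) (volume-formula i m _ c (deficiency Dₘ)))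
    (simpleTrade⇒hasVolume (doubleⁱ i (G-trade Dₘ)))
  where
  open Decomposition using (G-trade; deficiency)
  Dₘ = stepⁿ m D
  i+[m+1]≡1+[i+m] : ∀ i m → i + (m + 1) ≡ suc (i + m)
  i+[m+1]≡1+[i+m] = solve-∀

theorem5p3 : (t : ℕ) → 1 ≤ t →
    ((i : ℕ) → i + 2 ≤ t →
      HasSimpleTradeOfVolume t ((2 ^ (t + 1) + 2 ^ (t ∸ 1)) ∸ 2 ^ i)) ×
    ((i : ℕ) → i + 3 ≤ t →
      HasSimpleTradeOfVolume t ((2 ^ (t + 1) + 2 ^ (t ∸ 1)) ∸ 3 * 2 ^ i))
theorem5p3 t _ =
  (λ i i+2≤t → subst (λ k → HasSimpleTradeOfVolume t ((2 ^ (t + 1) + 2 ^ (t ∸ 1)) ∸ k))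
                     (*-identityˡ (2 ^ i))
                     (simple-trade-of-volume base₁ (<-≤-trans (m<m+n i z<s) i+2≤t))) ,
  (λ i i+3≤t → simple-trade-of-volume base₃ (<-≤-trans (m<m+n i z<s) i+3≤t))
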